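{- Let $\mathcal E$ be a path object category and $x\colon X\to\Gamma$ a morphism. Form the pullback $M_\Gamma(x)$ of $Mx\colon MX\to M\Gamma$ along $\alpha_{1,\Gamma}\colon M1\times\Gamma\to M\Gamma$, with projections $j_x\colon M_\Gamma(x)\to MX$ and $u_x\colon M_\Gamma(x)\to M1\times\Gamma$, and put $s_x=s_Xj_x$, $t_x=t_Xj_x$. Then the subgraph $(s_x,t_x)\colon M_\Gamma(x)\rightrightarrows X$ of $(s_X,t_X)\colon MX\rightrightarrows X$ is a subcategory of the internal category $MX\rightrightarrows X$ (i.e. $r_X$ and $m_X\circ(j_x\times_Xj_x)$ factor through $j_x$).
   Context: Path object category: finitely complete $\mathcal E$ with (Axiom 1) a pullback-preserving endofunctor $M$ and natural $s,t\colon MX\to X$, $r\colon X\to MX$, $m\colon MX\,{}_{s_X}\!\times_{t_X}MX\to MX$, $\tau\colon MX\to MX$ making $(X,MX,s_X,t_X,r_X,m_X)$ an internal category ($s_Xm_X=s_X\pi_2$, $t_Xm_X=t_X\pi_1$) with $\tau_X$ an involution giving an identity-on-objects isomorphism with its opposite; (Axiom 2) a strength $\alpha_{X,Y}\colon MX\times Y\to M(X\times Y)$ for which $s,t,r,m,\tau$ are strong natural transformations (here $\alpha_{1,\Gamma}$ is regarded as a map $M1\times\Gamma\to M(1\times\Gamma)\cong M\Gamma$); (Axiom 3) a strong natural $\eta\colon M\Rightarrow MM$ with $s_{MX}\eta_X=1$, $t_{MX}\eta_X=r_Xt_X$, $Ms_X\eta_X=1$, $Mt_X\eta_X=\alpha_{1,X}(M!,t_X)$,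 $\eta_Xr_X=r_{MX}r_X$. -}

module Defs where

open import Level using (Level; _⊔_) renaming (suc to lsuc)
open import Relation.Binary using (IsEquivalence; Setoid)
open import Data.Product using (Σ; _,_; proj₁; proj₂) renaming (_×_ to _∧_)
import Relation.Binary.Reasoning.Setoid as SetoidR

record Category (o ℓ e : Level) : Set (lsuc (o ⊔ ℓ ⊔ e)) where
  infix  4 _≈_ _⇒_
  infixr 9 _∘_
  field
    Obj  : Set o
    _⇒_  : Obj → Obj → Set ℓ
    _≈_  : ∀ {A B} → A ⇒ B → A ⇒ B → Set e
    id   : ∀ {A} → A ⇒ A
    _∘_  : ∀ {A B C} → B ⇒ C → A ⇒ B → A ⇒ C
    assoc     : ∀ {A B C D} {f : A ⇒ B} {g : B ⇒ C} {h : C ⇒ D} →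
                (h ∘ g) ∘ f ≈ h ∘ (g ∘ f)
    identityˡ : ∀ {A B} {f : A ⇒ B} → id ∘ f ≈ f
    identityʳ : ∀ {A B} {f : A ⇒ B} → f ∘ id ≈ f
    equiv     : ∀ {A B} → IsEquivalence (_≈_ {A} {B})
    ∘-resp-≈  : ∀ {A B C} {f h : B ⇒ C} {g i : A ⇒ B} →
                f ≈ h → g ≈ i → f ∘ g ≈ h ∘ i

  hom-setoid : ∀ {A B} → Setoid ℓ e
  hom-setoid {A} {B} = record { Carrier = A ⇒ B ; _≈_ = _≈_ ; isEquivalence = equiv }

  ≈-refl : ∀ {A B} {f : A ⇒ B} → f ≈ f
  ≈-refl = IsEquivalence.refl equiv
  ≈-sym : ∀ {A B} {f g : A ⇒ B} → f ≈ g → g ≈ f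
  ≈-sym = IsEquivalence.sym equiv
  ≈-trans : ∀ {A B} {f g h : A ⇒ B} → f ≈ g → g ≈ h → f ≈ h
  ≈-trans = IsEquivalence.trans equiv
  infixr 3 _■_
  _■_ : ∀ {A B} {f g h : A ⇒ B} → f ≈ g → g ≈ h → f ≈ h
  _■_ = ≈-trans

  record IsPullback {P A B C : Obj} (f : A ⇒ C) (g : B ⇒ C)
                    (p₁ : P ⇒ A) (p₂ : P ⇒ B) : Set (o ⊔ ℓ ⊔ e) where
    field
      commute   : f ∘ p₁ ≈ g ∘ p₂
      universal : ∀ {Q} {h₁ : Q ⇒ A} {h₂ : Q ⇒ B} → f ∘ h₁ ≈ g ∘ h₂ → Q ⇒ P
      p₁∘universal≈h₁ : ∀ {Q} {h₁ : Q ⇒ A} {h₂ : Q ⇒ B} (eq : f ∘ h₁ ≈ g ∘ h₂) →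
                        p₁ ∘ universal eq ≈ h₁
      p₂∘universal≈h₂ : ∀ {Q} {h₁ : Q ⇒ A} {h₂ : Q ⇒ B} (eq : f ∘ h₁ ≈ g ∘ h₂) →
                        p₂ ∘ universal eq ≈ h₂
      unique : ∀ {Q} {h₁ : Q ⇒ A} {h₂ : Q ⇒ B} (eq : f ∘ h₁ ≈ g ∘ h₂) (u : Q ⇒ P) →
               p₁ ∘ u ≈ h₁ → p₂ ∘ u ≈ h₂ → u ≈ universal eq

  record Pullback {A B C : Obj} (f : A ⇒ C) (g : B ⇒ C) : Set (o ⊔ ℓ ⊔ e) where
    field
      P  : Obj
      p₁ : P ⇒ A
      p₂ : P ⇒ B
      isPullback : IsPullback f g p₁ p₂
    open IsPullback isPullback public

  record Terminal : Set (o ⊔ ℓ ⊔ e) where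
    field
      ⊤ : Obj
      ! : ∀ {A} → A ⇒ ⊤
      !-unique : ∀ {A} (f : A ⇒ ⊤) → ! ≈ f

  record Product (A B : Obj) : Set (o ⊔ ℓ ⊔ e) where
    field
      A×B : Obj
      π₁  : A×B ⇒ A
      π₂  : A×B ⇒ B
      ⟨_,_⟩ : ∀ {C} → C ⇒ A → C ⇒ B → C ⇒ A×B
      project₁ : ∀ {C} {f : C ⇒ A} {g : C ⇒ B} → π₁ ∘ ⟨ f , g ⟩ ≈ f
      project₂ : ∀ {C} {f : C ⇒ A} {g : C ⇒ B} → π₂ ∘ ⟨ f , g ⟩ ≈ g
      unique   : ∀ {C} {h : C ⇒ A×B} {f : C ⇒ A} {g : C ⇒ B} →
                 π₁ ∘ h ≈ f → π₂ ∘ h ≈ g → ⟨ f , g ⟩ ≈ h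

record FinitelyComplete {o ℓ e} (𝒞 : Category o ℓ e) : Set (o ⊔ ℓ ⊔ e) where
  open Category 𝒞
  field
    terminal : Terminal
    product  : ∀ A B → Product A B
    pullback : ∀ {A B C} (f : A ⇒ C) (g : B ⇒ C) → Pullback f g

  open Terminal terminal public

  infixr 7 _×_
  infixr 8 _⁂_
  _×_ : Obj → Obj → Obj
  A × B = Product.A×B (product A B)

  π₁ : ∀ {A B} → A × B ⇒ A
  π₁ {A} {B} = Product.π₁ (product A B)
  π₂ : ∀ {A B} → A × B ⇒ B
  π₂ {A} {B} = Product.π₂ (product A B)
  ⟨_,_⟩ : ∀ {A B C} → C ⇒ A → C ⇒ B → C ⇒ A × B
  ⟨_,_⟩ {A} {B} = Product.⟨_,_⟩ (product A B)

  _⁂_ : ∀ {A B C D} → A ⇒ B → C ⇒ D → A × C ⇒ B × D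
  f ⁂ g = ⟨ f ∘ π₁ , g ∘ π₂ ⟩

  assocʳ : ∀ {A B C} → (A × B) × C ⇒ A × (B × C)
  assocʳ = ⟨ π₁ ∘ π₁ , ⟨ π₂ ∘ π₁ , π₂ ⟩ ⟩

  private
    module _ {A B : Obj} where
      open Product (product A B) public using (project₁; project₂; unique)

  ⁂∘⁂ : ∀ {A B C D E F} {f : B ⇒ C} {g : E ⇒ F} {h : A ⇒ B} {k : D ⇒ E} →
        (f ⁂ g) ∘ (h ⁂ k) ≈ (f ∘ h) ⁂ (g ∘ k)
  ⁂∘⁂ {f = f} {g} {h} {k} = ≈-sym (unique l r)
    where
      l = (≈-sym assoc) ■ (∘-resp-≈ project₁ ≈-refl) ■ (assoc) ■ (∘-resp-≈ ≈-refl project₁) ■ (≈-sym assoc)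
      r = (≈-sym assoc) ■ (∘-resp-≈ project₂ ≈-refl) ■ (assoc) ■ (∘-resp-≈ ≈-refl project₂) ■ (≈-sym assoc)

  ⁂-resp-≈ : ∀ {A B C D} {f f′ : A ⇒ B} {g g′ : C ⇒ D} →
             f ≈ f′ → g ≈ g′ → f ⁂ g ≈ f′ ⁂ g′
  ⁂-resp-≈ ef eg = ≈-sym (
    unique (≈-trans project₁ (∘-resp-≈ ef ≈-refl))
           (≈-trans project₂ (∘-resp-≈ eg ≈-refl)))

record Functor {o ℓ e} (𝒞 : Category o ℓ e) : Set (o ⊔ ℓ ⊔ e) where
  open Category 𝒞
  field
    F₀ : Obj → Obj
    F₁ : ∀ {A B} → A ⇒ B → F₀ A ⇒ F₀ B
    identity     : ∀ {A} → F₁ (id {A}) ≈ id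
    homomorphism : ∀ {A B C} {f : A ⇒ B} {g : B ⇒ C} → F₁ (g ∘ f) ≈ F₁ g ∘ F₁ f
    F-resp-≈     : ∀ {A B} {f g : A ⇒ B} → f ≈ g → F₁ f ≈ F₁ g

PreservesPullbacks : ∀ {o ℓ e} {𝒞 : Category o ℓ e} → Functor 𝒞 → Set (o ⊔ ℓ ⊔ e)
PreservesPullbacks {𝒞 = 𝒞} F =
  ∀ {P A B C} {f : A ⇒ C} {g : B ⇒ C} {p₁ : P ⇒ A} {p₂ : P ⇒ B} →
  IsPullback f g p₁ p₂ → IsPullback (F₁ f) (F₁ g) (F₁ p₁) (F₁ p₂)
  where open Category 𝒞
        open Functor F

-- Path object categories (Axioms 1-3)

record PathObjectCategory {o ℓ e} (𝒞 : Category o ℓ e) : Set (o ⊔ ℓ ⊔ e) where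
  open Category 𝒞
  field
    finitelyComplete : FinitelyComplete 𝒞
  open FinitelyComplete finitelyComplete public

  field
    M : Functor 𝒞
    M-preserves-pullbacks : PreservesPullbacks M
  open Functor M public

  field
    s t : ∀ X → F₀ X ⇒ X
    r   : ∀ X → X ⇒ F₀ X
    s-natural : ∀ {X Y} (f : X ⇒ Y) → s Y ∘ F₁ f ≈ f ∘ s X
    t-natural : ∀ {X Y} (f : X ⇒ Y) → t Y ∘ F₁ f ≈ f ∘ t X
    r-natural : ∀ {X Y} (f : X ⇒ Y) → r Y ∘ f ≈ F₁ f ∘ r X

  Comp : Obj → Obj
  Comp X = Pullback.P (pullback (s X) (t X))
  c₁ : ∀ X → Comp X ⇒ F₀ X
  c₁ X = Pullback.p₁ (pullback (s X) (t X))
  c₂ : ∀ X → Comp X ⇒ F₀ X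
  c₂ X = Pullback.p₂ (pullback (s X) (t X))
  c-commute : ∀ X → s X ∘ c₁ X ≈ t X ∘ c₂ X
  c-commute X = Pullback.commute (pullback (s X) (t X))
  compPair : ∀ {X Q} (a b : Q ⇒ F₀ X) → s X ∘ a ≈ t X ∘ b → Q ⇒ Comp X
  compPair {X} a b eq = Pullback.universal (pullback (s X) (t X)) eq

  field
    m : ∀ X → Comp X ⇒ F₀ X
    τ : ∀ X → F₀ X ⇒ F₀ X

  Triple : Obj → Obj
  Triple X = Pullback.P (pullback (s X ∘ c₂ X) (t X))
  d₁ : ∀ X → Triple X ⇒ Comp X
  d₁ X = Pullback.p₁ (pullback (s X ∘ c₂ X) (t X))
  d₂ : ∀ X → Triple X ⇒ F₀ X
  d₂ X = Pullback.p₂ (pullback (s X ∘ c₂ X) (t X))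
  d-commute : ∀ X → (s X ∘ c₂ X) ∘ d₁ X ≈ t X ∘ d₂ X
  d-commute X = Pullback.commute (pullback (s X ∘ c₂ X) (t X))

  field
    s∘r : ∀ X → s X ∘ r X ≈ id
    t∘r : ∀ X → t X ∘ r X ≈ id
    s∘m : ∀ X → s X ∘ m X ≈ s X ∘ c₂ X
    t∘m : ∀ X → t X ∘ m X ≈ t X ∘ c₁ X

  eqL : ∀ X → s X ∘ (r X ∘ t X) ≈ t X ∘ id
  eqL X = (≈-sym assoc) ■ (∘-resp-≈ (s∘r X) ≈-refl) ■ (identityˡ) ■ (≈-sym identityʳ)
  eqR : ∀ X → s X ∘ id ≈ t X ∘ (r X ∘ s X)
  eqR X = (identityʳ) ■ (≈-sym identityˡ) ■ (∘-resp-≈ (≈-sym (t∘r X)) ≈-refl) ■ (assoc)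

  leftUnitPair : ∀ X → F₀ X ⇒ Comp X
  leftUnitPair X = compPair (r X ∘ t X) id (eqL X)
  rightUnitPair : ∀ X → F₀ X ⇒ Comp X
  rightUnitPair X = compPair id (r X ∘ s X) (eqR X)

  eqA : ∀ X → s X ∘ (m X ∘ d₁ X) ≈ t X ∘ d₂ X
  eqA X = (≈-sym assoc) ■ (∘-resp-≈ (s∘m X) ≈-refl) ■ (d-commute X)
  eqB : ∀ X → s X ∘ (c₂ X ∘ d₁ X) ≈ t X ∘ d₂ X
  eqB X = ≈-trans (≈-sym assoc) (d-commute X)
  inner : ∀ X → Triple X ⇒ Comp X
  inner X = compPair (c₂ X ∘ d₁ X) (d₂ X) (eqB X)
  eqC : ∀ X → s X ∘ (c₁ X ∘ d₁ X) ≈ t X ∘ (m X ∘ inner X)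
  eqC X = (≈-sym assoc) ■ (∘-resp-≈ (c-commute X) ≈-refl) ■ (assoc) ■ (∘-resp-≈ ≈-refl (≈-sym (Pullback.p₁∘universal≈h₁ (pullback (s X) (t X)) (eqB X)))) ■ (≈-sym assoc) ■ (∘-resp-≈ (≈-sym (t∘m X)) ≈-refl) ■ (assoc)

  m⁂1 : ∀ X → Triple X ⇒ Comp X
  m⁂1 X = compPair (m X ∘ d₁ X) (d₂ X) (eqA X)
  1⁂m : ∀ X → Triple X ⇒ Comp X
  1⁂m X = compPair (c₁ X ∘ d₁ X) (m X ∘ inner X) (eqC X)

  eqN : ∀ {X Y} (f : X ⇒ Y) → s Y ∘ (F₁ f ∘ c₁ X) ≈ t Y ∘ (F₁ f ∘ c₂ X)
  eqN {X} {Y} f = (≈-sym assoc) ■ (∘-resp-≈ (s-natural f) ≈-refl) ■ (assoc) ■ (∘-resp-≈ ≈-refl (c-commute X)) ■ (≈-sym assoc) ■ (∘-resp-≈ (≈-sym (t-natural f)) ≈-refl) ■ (assoc)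

  Comp₁ : ∀ {X Y} → X ⇒ Y → Comp X ⇒ Comp Y
  Comp₁ {X} f = compPair (F₁ f ∘ c₁ X) (F₁ f ∘ c₂ X) (eqN f)

  -- (τ c₂ , τ c₁) : the swap needed for τ to reverse composition, given s τ = t, t τ = s
  field
    s∘τ : ∀ X → s X ∘ τ X ≈ t X
    t∘τ : ∀ X → t X ∘ τ X ≈ s X

  eqT : ∀ X → s X ∘ (τ X ∘ c₂ X) ≈ t X ∘ (τ X ∘ c₁ X)
  eqT X = (≈-sym assoc) ■ (∘-resp-≈ (s∘τ X) ≈-refl) ■ (≈-sym (c-commute X)) ■ (∘-resp-≈ (≈-sym (t∘τ X)) ≈-refl) ■ (assoc)

  τswap : ∀ X → Comp X ⇒ Comp X
  τswap X = compPair (τ X ∘ c₂ X) (τ X ∘ c₁ X) (eqT X)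

  field
    m∘leftUnit  : ∀ X → m X ∘ leftUnitPair X ≈ id
    m∘rightUnit : ∀ X → m X ∘ rightUnitPair X ≈ id
    m-assoc     : ∀ X → m X ∘ m⁂1 X ≈ m X ∘ 1⁂m X
    -- τ is an involutive identity-on-objects internal functor to the opposite
    τ∘r : ∀ X → τ X ∘ r X ≈ r X
    τ∘m : ∀ X → τ X ∘ m X ≈ m X ∘ τswap X
    τ-involutive : ∀ X → τ X ∘ τ X ≈ id
    m-natural : ∀ {X Y} (f : X ⇒ Y) → m Y ∘ Comp₁ f ≈ F₁ f ∘ m X
    τ-natural : ∀ {X Y} (f : X ⇒ Y) → τ Y ∘ F₁ f ≈ F₁ f ∘ τ X

  field
    α : ∀ X Y → F₀ X × Y ⇒ F₀ (X × Y)
    α-natural : ∀ {X X′ Y Y′} (f : X ⇒ X′) (g : Y ⇒ Y′) →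
                F₁ (f ⁂ g) ∘ α X Y ≈ α X′ Y′ ∘ (F₁ f ⁂ g)
    α-unit    : ∀ X → F₁ π₁ ∘ α X ⊤ ≈ π₁
    α-assoc   : ∀ X Y Z →
                α X (Y × Z) ∘ assocʳ ≈ F₁ assocʳ ∘ (α (X × Y) Z ∘ (α X Y ⁂ id))
    s-strong : ∀ X Y → s (X × Y) ∘ α X Y ≈ s X ⁂ id
    t-strong : ∀ X Y → t (X × Y) ∘ α X Y ≈ t X ⁂ id
    r-strong : ∀ X Y → r (X × Y) ≈ α X Y ∘ (r X ⁂ id)
    τ-strong : ∀ X Y → τ (X × Y) ∘ α X Y ≈ α X Y ∘ (τ X ⁂ id)

  eqS : ∀ X Y → s (X × Y) ∘ (α X Y ∘ (c₁ X ⁂ id)) ≈ t (X × Y) ∘ (α X Y ∘ (c₂ X ⁂ id))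
  eqS X Y = (≈-sym assoc) ■ (∘-resp-≈ (s-strong X Y) ≈-refl) ■ (⁂∘⁂) ■ (⁂-resp-≈ (c-commute X) ≈-refl) ■ (≈-sym ⁂∘⁂) ■ (∘-resp-≈ (≈-sym (t-strong X Y)) ≈-refl) ■ (assoc)

  αComp : ∀ X Y → Comp X × Y ⇒ Comp (X × Y)
  αComp X Y = compPair (α X Y ∘ (c₁ X ⁂ id)) (α X Y ∘ (c₂ X ⁂ id)) (eqS X Y)

  field
    m-strong : ∀ X Y → m (X × Y) ∘ αComp X Y ≈ α X Y ∘ (m X ⁂ id)

  field
    η : ∀ X → F₀ X ⇒ F₀ (F₀ X)
    η-natural : ∀ {X Y} (f : X ⇒ Y) → η Y ∘ F₁ f ≈ F₁ (F₁ f) ∘ η X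
    -- strength of MM is  M α ∘ α_M
    η-strong  : ∀ X Y → η (X × Y) ∘ α X Y ≈ F₁ (α X Y) ∘ (α (F₀ X) Y ∘ (η X ⁂ id))
    sM∘η : ∀ X → s (F₀ X) ∘ η X ≈ id
    tM∘η : ∀ X → t (F₀ X) ∘ η X ≈ r X ∘ t X
    Ms∘η : ∀ X → F₁ (s X) ∘ η X ≈ id
    -- α_{1,X} regarded as a map M1 × X → MX via M(1 × X) ≅ MX (i.e. composed with Mπ₂)
    Mt∘η : ∀ X → F₁ (t X) ∘ η X ≈ F₁ π₂ ∘ (α ⊤ X ∘ ⟨ F₁ ! , t X ⟩)
    η∘r  : ∀ X → η X ∘ r X ≈ r (F₀ X) ∘ r X

  α₁ : ∀ Γ → F₀ ⊤ × Γ ⇒ F₀ Γ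
  α₁ Γ = F₁ π₂ ∘ α ⊤ Γ

  module SubGraph {X A : Obj} (j : A ⇒ F₀ X) where
    PB : Pullback (s X ∘ j) (t X ∘ j)
    PB = pullback (s X ∘ j) (t X ∘ j)
    A×ₓA : Obj
    A×ₓA = Pullback.P PB
    j×ₓj : A×ₓA ⇒ Comp X
    j×ₓj = compPair (j ∘ Pullback.p₁ PB) (j ∘ Pullback.p₂ PB)
             (≈-trans (≈-sym assoc) (≈-trans (Pullback.commute PB) assoc))

  IsSubcategory : ∀ {X A : Obj} (j : A ⇒ F₀ X) → Set (ℓ ⊔ e)
  IsSubcategory {X} {A} j =
    Σ (X ⇒ A) (λ ρ → j ∘ ρ ≈ r X) ∧
    Σ (A×ₓA ⇒ A) (λ μ → j ∘ μ ≈ m X ∘ j×ₓj)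
    where open SubGraph j

module Submission where

-- Call a path in MΓ *constant* when it lies in the image of α₁, i.e. it
-- is α₁(p, γ) for a path p in M1 and a point γ of Γ.  By construction an
-- element of MX lies in M_Γ(x) exactly when its image under Mx is constant,
-- so it suffices to show, using the pullback property of M_Γ(x), that:
--   * identity paths are constant:  r_Γ γ = α₁(r_1 !, γ)     (strength of r);
--   * both endpoints of α₁(p, γ) are γ                        (strength of s, t),
--     so two paths of M_Γ(x) that are composable in MX have images lying
--     over the same point γ of Γ; their M1-parts are always composable;
--   * the composite of α₁(p, γ) and α₁(p′, γ) is α₁(p ∘ p′, γ)
--                                                 (naturality and strength of m).
-- Naturality of r and m (Mx r_X = r_Γ x, Mx m_X = m_Γ (Mx ×_x Mx)) then sends
-- identities and composites of M_Γ(x) to constant paths, which gives the two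
-- factorisations required by IsSubcategory.

open import Defs
open import Level using (_⊔_)
open import Data.Product using (Σ; _,_)
import Relation.Binary.Reasoning.Setoid as SetoidR

module Proof {o ℓ e} {𝒞 : Category o ℓ e} (𝓔 : PathObjectCategory 𝒞) where
  open Category 𝒞
  open PathObjectCategory 𝓔

  module HomReasoning {A B : Obj} = SetoidR (hom-setoid {A} {B})
  open HomReasoning using (begin_; step-≈-⟩; step-≈-⟨; _∎)

  pullˡ : ∀ {A B C D} {f : C ⇒ D} {g : B ⇒ C} {h : B ⇒ D} {k : A ⇒ B} →
          f ∘ g ≈ h → f ∘ (g ∘ k) ≈ h ∘ k
  pullˡ fg≈h = ≈-trans (≈-sym assoc) (∘-resp-≈ fg≈h ≈-refl)

  pushˡ : ∀ {A B C D} {f : C ⇒ D} {g : B ⇒ C} {h : B ⇒ D} {k : A ⇒ B} →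
          h ≈ f ∘ g → h ∘ k ≈ f ∘ (g ∘ k)
  pushˡ h≈fg = ≈-sym (pullˡ (≈-sym h≈fg))

  module _ {A B : Obj} where
    open Product (product A B) public
      using (project₁; project₂) renaming (unique to ⟨⟩-unique)

  ⟨⟩-cong : ∀ {A B C} {f f′ : C ⇒ A} {g g′ : C ⇒ B} →
            f ≈ f′ → g ≈ g′ → ⟨ f , g ⟩ ≈ ⟨ f′ , g′ ⟩
  ⟨⟩-cong f≈f′ g≈g′ = ≈-sym (⟨⟩-unique (≈-trans project₁ f≈f′) (≈-trans project₂ g≈g′))

  ⁂∘⟨⟩ : ∀ {A B C D E} {f : A ⇒ B} {g : C ⇒ D} {h : E ⇒ A} {k : E ⇒ C} →
         (f ⁂ g) ∘ ⟨ h , k ⟩ ≈ ⟨ f ∘ h , g ∘ k ⟩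
  ⁂∘⟨⟩ = ≈-sym (⟨⟩-unique (pullˡ project₁ ■ assoc ■ ∘-resp-≈ ≈-refl project₁)
                          (pullˡ project₂ ■ assoc ■ ∘-resp-≈ ≈-refl project₂))

  c₁∘compPair : ∀ {X Q} {a b : Q ⇒ F₀ X} (eq : s X ∘ a ≈ t X ∘ b) → c₁ X ∘ compPair a b eq ≈ a
  c₁∘compPair {X} = Pullback.p₁∘universal≈h₁ (pullback (s X) (t X))

  c₂∘compPair : ∀ {X Q} {a b : Q ⇒ F₀ X} (eq : s X ∘ a ≈ t X ∘ b) → c₂ X ∘ compPair a b eq ≈ b
  c₂∘compPair {X} = Pullback.p₂∘universal≈h₂ (pullback (s X) (t X))

  Comp-ext : ∀ {X Q} {f g : Q ⇒ Comp X} →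
             c₁ X ∘ f ≈ c₁ X ∘ g → c₂ X ∘ f ≈ c₂ X ∘ g → f ≈ g
  Comp-ext {X} {f = f} {g} e₁ e₂ =
    unique eq f ≈-refl ≈-refl ■ ≈-sym (unique eq g (≈-sym e₁) (≈-sym e₂))
    where
      open Pullback (pullback (s X) (t X)) using (unique)
      eq = pullˡ (c-commute X) ■ assoc

  -- Any two paths in M1 are composable, since 1 is terminal.
  pair₁ : ∀ {Q} → Q ⇒ F₀ ⊤ → Q ⇒ F₀ ⊤ → Q ⇒ Comp ⊤
  pair₁ p p′ = compPair p p′ (≈-sym (!-unique _) ■ !-unique _)

  record Endpoint : Set (o ⊔ ℓ ⊔ e) where
    field
      ε       : ∀ X → F₀ X ⇒ X
      natural : ∀ {X Y} (f : X ⇒ Y) → ε Y ∘ F₁ f ≈ f ∘ ε X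
      strong  : ∀ X Y → ε (X × Y) ∘ α X Y ≈ ε X ⁂ id

    ε∘α₁ : ∀ Γ → ε Γ ∘ α₁ Γ ≈ π₂
    ε∘α₁ Γ = begin
      ε Γ ∘ (F₁ π₂ ∘ α ⊤ Γ)      ≈⟨ pullˡ (natural π₂) ⟩
      (π₂ ∘ ε (⊤ × Γ)) ∘ α ⊤ Γ   ≈⟨ assoc ⟩
      π₂ ∘ (ε (⊤ × Γ) ∘ α ⊤ Γ)   ≈⟨ ∘-resp-≈ ≈-refl (strong ⊤ Γ) ⟩
      π₂ ∘ (ε ⊤ ⁂ id)            ≈⟨ project₂ ⟩
      id ∘ π₂                    ≈⟨ identityˡ ⟩
      π₂                         ∎

    base-of-constant : ∀ {X Γ Q} (x : X ⇒ Γ) {j : Q ⇒ F₀ X} {u : Q ⇒ F₀ ⊤ × Γ} →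
                       F₁ x ∘ j ≈ α₁ Γ ∘ u → π₂ ∘ u ≈ x ∘ (ε X ∘ j)
    base-of-constant {X} {Γ} x {j} {u} square = begin
      π₂ ∘ u                 ≈⟨ ∘-resp-≈ (ε∘α₁ Γ) ≈-refl ⟨
      (ε Γ ∘ α₁ Γ) ∘ u       ≈⟨ assoc ⟩
      ε Γ ∘ (α₁ Γ ∘ u)       ≈⟨ ∘-resp-≈ ≈-refl square ⟨
      ε Γ ∘ (F₁ x ∘ j)       ≈⟨ pullˡ (natural x) ⟩
      (x ∘ ε X) ∘ j          ≈⟨ assoc ⟩
      x ∘ (ε X ∘ j)          ∎

  source target : Endpoint
  source = record { ε = s ; natural = s-natural ; strong = s-strong }
  target = record { ε = t ; natural = t-natural ; strong = t-strong }

  r-constant : ∀ {Γ Q} (γ : Q ⇒ Γ) → r Γ ∘ γ ≈ α₁ Γ ∘ ⟨ r ⊤ ∘ ! , γ ⟩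
  r-constant {Γ} γ = begin
    r Γ ∘ γ                               ≈⟨ ∘-resp-≈ ≈-refl project₂ ⟨
    r Γ ∘ (π₂ ∘ ⟨ ! , γ ⟩)                ≈⟨ pullˡ (r-natural π₂) ⟩
    (F₁ π₂ ∘ r (⊤ × Γ)) ∘ ⟨ ! , γ ⟩       ≈⟨ pushˡ (∘-resp-≈ ≈-refl (r-strong ⊤ Γ)) ⟩
    F₁ π₂ ∘ ((α ⊤ Γ ∘ (r ⊤ ⁂ id)) ∘ ⟨ ! , γ ⟩)
                                          ≈⟨ ∘-resp-≈ ≈-refl assoc ⟩
    F₁ π₂ ∘ (α ⊤ Γ ∘ ((r ⊤ ⁂ id) ∘ ⟨ ! , γ ⟩))
                                          ≈⟨ ≈-sym assoc ⟩
    α₁ Γ ∘ ((r ⊤ ⁂ id) ∘ ⟨ ! , γ ⟩)       ≈⟨ ∘-resp-≈ ≈-refl (⁂∘⟨⟩ ■ ⟨⟩-cong ≈-refl identityˡ) ⟩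
    α₁ Γ ∘ ⟨ r ⊤ ∘ ! , γ ⟩                ∎

  α₁Comp : ∀ Γ → Comp ⊤ × Γ ⇒ Comp Γ
  α₁Comp Γ = Comp₁ π₂ ∘ αComp ⊤ Γ

  c₁∘α₁Comp : ∀ Γ → c₁ Γ ∘ α₁Comp Γ ≈ α₁ Γ ∘ (c₁ ⊤ ⁂ id)
  c₁∘α₁Comp Γ = pullˡ (c₁∘compPair (eqN π₂)) ■ assoc
              ■ ∘-resp-≈ ≈-refl (c₁∘compPair (eqS ⊤ Γ)) ■ ≈-sym assoc

  c₂∘α₁Comp : ∀ Γ → c₂ Γ ∘ α₁Comp Γ ≈ α₁ Γ ∘ (c₂ ⊤ ⁂ id)
  c₂∘α₁Comp Γ = pullˡ (c₂∘compPair (eqN π₂)) ■ assoc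
              ■ ∘-resp-≈ ≈-refl (c₂∘compPair (eqS ⊤ Γ)) ■ ≈-sym assoc

  m∘α₁Comp : ∀ Γ → m Γ ∘ α₁Comp Γ ≈ α₁ Γ ∘ (m ⊤ ⁂ id)
  m∘α₁Comp Γ = pullˡ (m-natural π₂) ■ assoc ■ ∘-resp-≈ ≈-refl (m-strong ⊤ Γ) ■ ≈-sym assoc

  composite-constant : ∀ {Γ Q} (v w : Q ⇒ F₀ ⊤ × Γ) → π₂ ∘ v ≈ π₂ ∘ w →
                       (f : Q ⇒ Comp Γ) → c₁ Γ ∘ f ≈ α₁ Γ ∘ v → c₂ Γ ∘ f ≈ α₁ Γ ∘ w →
                       m Γ ∘ f ≈ α₁ Γ ∘ ⟨ m ⊤ ∘ pair₁ (π₁ ∘ v) (π₁ ∘ w) , π₂ ∘ v ⟩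
  composite-constant {Γ} {Q} v w same-base f c₁f c₂f = begin
    m Γ ∘ f                          ≈⟨ ∘-resp-≈ ≈-refl f≈α₁Comp ⟩
    m Γ ∘ (α₁Comp Γ ∘ k)             ≈⟨ pullˡ (m∘α₁Comp Γ) ■ assoc ⟩
    α₁ Γ ∘ ((m ⊤ ⁂ id) ∘ k)          ≈⟨ ∘-resp-≈ ≈-refl (⁂∘⟨⟩ ■ ⟨⟩-cong ≈-refl identityˡ) ⟩
    α₁ Γ ∘ ⟨ m ⊤ ∘ pair , π₂ ∘ v ⟩   ∎
    where
      pair = pair₁ (π₁ ∘ v) (π₁ ∘ w)
      k = ⟨ pair , π₂ ∘ v ⟩
      reassemble : ∀ {c : Comp ⊤ ⇒ F₀ ⊤} {y : Q ⇒ F₀ ⊤ × Γ} →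
                   c ∘ pair ≈ π₁ ∘ y → π₂ ∘ v ≈ π₂ ∘ y → (c ⁂ id) ∘ k ≈ y
      reassemble e₁ e₂ = ⁂∘⟨⟩ ■ ⟨⟩-unique (≈-sym e₁) (≈-sym e₂ ■ ≈-sym identityˡ)
      f≈α₁Comp : f ≈ α₁Comp Γ ∘ k
      f≈α₁Comp = Comp-ext
        (c₁f ■ ≈-sym (pullˡ (c₁∘α₁Comp Γ) ■ assoc
                      ■ ∘-resp-≈ ≈-refl (reassemble (c₁∘compPair _) ≈-refl)))
        (c₂f ■ ≈-sym (pullˡ (c₂∘α₁Comp Γ) ■ assoc
                      ■ ∘-resp-≈ ≈-refl (reassemble (c₂∘compPair _) same-base)))

  module _ {X Γ : Obj} (x : X ⇒ Γ) (Mₓ : Pullback (F₁ x) (α₁ Γ)) where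
    open Pullback Mₓ renaming (p₁ to j; p₂ to u; commute to square)
    open SubGraph j
    open Pullback PB renaming (p₁ to a; p₂ to b; commute to composable)
      using ()

    -- r_X factors through j_x, since Mx sends identities to constant paths.
    identities-in-Mₓ : Σ (X ⇒ P) (λ ρ → j ∘ ρ ≈ r X)
    identities-in-Mₓ = universal Mx∘r , p₁∘universal≈h₁ Mx∘r
      where
        Mx∘r : F₁ x ∘ r X ≈ α₁ Γ ∘ ⟨ r ⊤ ∘ ! , x ⟩
        Mx∘r = ≈-sym (r-natural x) ■ r-constant x

    -- m_X ∘ (j_x ×_X j_x) factors through j_x, since Mx sends composites of
    -- paths in M_Γ(x) to composites of constant paths over a common point.
    composites-in-Mₓ : Σ (A×ₓA ⇒ P) (λ μ → j ∘ μ ≈ m X ∘ j×ₓj)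
    composites-in-Mₓ = universal Mx∘m , p₁∘universal≈h₁ Mx∘m
      where
        same-base : π₂ ∘ (u ∘ a) ≈ π₂ ∘ (u ∘ b)
        same-base = begin
          π₂ ∘ (u ∘ a)         ≈⟨ pullˡ (Endpoint.base-of-constant source x square) ■ assoc ⟩
          x ∘ ((s X ∘ j) ∘ a)  ≈⟨ ∘-resp-≈ ≈-refl composable ⟩
          x ∘ ((t X ∘ j) ∘ b)  ≈⟨ pullˡ (Endpoint.base-of-constant target x square) ■ assoc ⟨
          π₂ ∘ (u ∘ b)         ∎
        component : ∀ {c : ∀ Y → Comp Y ⇒ F₀ Y} {p : A×ₓA ⇒ P} →
                    c Γ ∘ Comp₁ x ≈ F₁ x ∘ c X → c X ∘ j×ₓj ≈ j ∘ p →
                    c Γ ∘ (Comp₁ x ∘ j×ₓj) ≈ α₁ Γ ∘ (u ∘ p)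
        component c∘Comp₁ c∘j×j = pullˡ c∘Comp₁ ■ assoc ■ ∘-resp-≈ ≈-refl c∘j×j
                                ■ pullˡ square ■ assoc
        Mx∘m : F₁ x ∘ (m X ∘ j×ₓj) ≈
               α₁ Γ ∘ ⟨ m ⊤ ∘ pair₁ (π₁ ∘ (u ∘ a)) (π₁ ∘ (u ∘ b)) , π₂ ∘ (u ∘ a) ⟩
        Mx∘m = pullˡ (≈-sym (m-natural x)) ■ assoc
             ■ composite-constant (u ∘ a) (u ∘ b) same-base (Comp₁ x ∘ j×ₓj)
                 (component (c₁∘compPair (eqN x)) (c₁∘compPair _))
                 (component (c₂∘compPair (eqN x)) (c₂∘compPair _))

proposition6p6 : ∀ {o ℓ e} {𝒞 : Category o ℓ e} (𝓔 : PathObjectCategory 𝒞) →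
    let open Category 𝒞
        open PathObjectCategory 𝓔
    in ∀ {X Γ : Obj} (x : X ⇒ Γ) (Mₓ : Pullback (F₁ x) (α₁ Γ)) →
       IsSubcategory (Pullback.p₁ Mₓ)
proposition6p6 𝓔 x Mₓ = identities-in-Mₓ x Mₓ , composites-in-Mₓ x Mₓ
  where open Proof 𝓔
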